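{- Let $\Sigma=\{\mathtt{0},\mathtt{1},\mathtt{*}\}$ and $n\ge1$. There is a Boolean circuit with $3^n$ input bits and $3^n$ output bits, both indexed by $\Sigma^n$, consisting of $n3^{n-1}$ OR gates, $n3^{n-1}$ NOT gates and $n3^n$ AND gates, with the following property: for every Boolean function $f:\{0,1\}^n\to\{0,1\}$, if the input bit indexed by $s\in\Sigma^n$ is $1$ exactly when $s\in\{\mathtt{0},\mathtt{1}\}^n$ and $f(s)=1$, then the output bit indexed by $s\in\Sigma^n$ is $1$ exactly when $s$ is a prime implicant of $f$.
   Context: A minterm over variables $x_1,\ldots,x_n$ is a product of literals ($x_i$ or its negation $x_i'$) in which every variable occurs at most once. It is identified with a string $s\in\Sigma^n$, where $s_k=\mathtt{0}$ if $x_k'$ occurs, $s_k=\mathtt{1}$ if $x_k$ occurs, and $s_k=\mathtt{*}$ (wildcard) otherwise; it evaluates to $1$ at $x\in\{0,1\}^n$ iff $x_k=s_k$ at all non-wildcard positions. A minterm is an implicant of $f$ if it evaluating to $1$ at $x$ implies $f(x)=1$ for all $x$. An implicant is prime if no proper divisor of it (i.e., no minterm obtained by deleting at least one literal, equivalently replacing at least one non-wildcard symbol of the string by $\mathtt{*}$) is an implicant of $f$. Points of $\{0,1\}^n$ are identified with strings in $\{\mathtt{0},\mathtt{1}\}^n\subseteq\Sigma^n$. -}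

module Defs where

open import Data.Bool using (Bool; true; false; _∧_; _∨_; not)
open import Data.Nat using (ℕ; zero; suc; _+_)
open import Data.Fin using (Fin; zero; suc)
open import Data.Maybe using (Maybe; just; nothing)
import Data.Maybe as Maybe
open import Data.Sum using (_⊎_; inj₁; inj₂)
open import Data.Vec using (Vec; lookup)
open import Relation.Binary.PropositionalEquality using (_≡_; _≢_)
open import Relation.Nullary using (¬_)

data Sym : Set where
  s0 s1 s* : Sym

embedBit : Bool → Sym
embedBit false = s0
embedBit true  = s1

embed : ∀ {n} → Vec Bool n → Vec Sym n
embed = Data.Vec.map embedBit

SymMatches : Sym → Bool → Set
SymMatches s0 b = b ≡ false
SymMatches s1 b = b ≡ true
SymMatches s* b = Data.Unit.⊤
  where import Data.Unit

Covers : ∀ {n} → Vec Sym n → Vec Bool n → Set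
Covers {n} s x = (k : Fin n) → SymMatches (lookup s k) (lookup x k)

Implicant : ∀ {n} → (Vec Bool n → Bool) → Vec Sym n → Set
Implicant {n} f s = (x : Vec Bool n) → Covers s x → f x ≡ true

ProperDivisor : ∀ {n} → Vec Sym n → Vec Sym n → Set
ProperDivisor {n} t s =
  ((k : Fin n) → (lookup t k ≡ lookup s k) ⊎ (lookup t k ≡ s*)) × (t ≢ s)
  where open import Data.Product using (_×_)

PrimeImplicant : ∀ {n} → (Vec Bool n → Bool) → Vec Sym n → Set
PrimeImplicant {n} f s =
  Implicant f s × ((t : Vec Sym n) → ProperDivisor t s → ¬ Implicant f t)
  where open import Data.Product using (_×_)

-- A circuit with m gates is a sequence of
-- gates; the wires available to gate number j are the inputs (inj₁) and
-- the earlier gates (inj₂ of Fin j).  So the circuit is acyclic.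

data Gate (W : Set) : Set where
  AND : W → W → Gate W
  OR  : W → W → Gate W
  NOT : W → Gate W

data Circuit (I : Set) : ℕ → Set where
  []  : Circuit I 0
  _▷_ : ∀ {m} → Circuit I m → Gate (I ⊎ Fin m) → Circuit I (suc m)

splitLast : ∀ m → Fin (suc m) → Maybe (Fin m)
splitLast zero    zero    = nothing
splitLast (suc m) zero    = just zero
splitLast (suc m) (suc i) = Maybe.map suc (splitLast m i)

evalGate : ∀ {W : Set} → (W → Bool) → Gate W → Bool
evalGate v (AND a b) = v a ∧ v b
evalGate v (OR a b)  = v a ∨ v b
evalGate v (NOT a)   = not (v a)

wireVal : ∀ {I m} → Circuit I m → (I → Bool) → I ⊎ Fin m → Bool
wireVal c x (inj₁ i) = x i
wireVal [] x (inj₂ ())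
wireVal {m = suc m} (c ▷ g) x (inj₂ j) with splitLast m j
... | just i  = wireVal c x (inj₂ i)
... | nothing = evalGate (wireVal c x) g

isAND isOR isNOT : ∀ {W} → Gate W → ℕ
isAND (AND _ _) = 1
isAND _         = 0
isOR (OR _ _)   = 1
isOR _          = 0
isNOT (NOT _)   = 1
isNOT _         = 0

#AND #OR #NOT : ∀ {I m} → Circuit I m → ℕ
#AND []      = 0
#AND (c ▷ g) = #AND c + isAND g
#OR []       = 0
#OR (c ▷ g)  = #OR c + isOR g
#NOT []      = 0
#NOT (c ▷ g) = #NOT c + isNOT g

-- A minterm * ∷ s is an implicant iff 0 ∷ s and 1 ∷ s are, so the implicant table is computed from
-- the input table by recursion on the first symbol, slice by slice, with one AND gate per pair
-- (minterm, starred position): n·3ⁿ⁻¹ gates. Like the layered circuit of the paper, the recursion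
-- also processes the star slice of the input, whose result is then overwritten.
-- Since implicants stay implicants under specialisation and every proper divisor of s divides a
-- single-literal deletion of s, an implicant is prime iff none of its single-literal deletions is an
-- implicant. Testing this costs one NOT per starred entry and one AND per literal, i.e. n·3ⁿ⁻¹ NOT
-- and 2n·3ⁿ⁻¹ AND gates.

module Submission where

open import Defs
open import Data.Bool using (Bool; true; false; _∧_; not)
open import Data.Fin using (Fin; zero; suc; inject₁; fromℕ)
open import Data.Fin.Properties using (¬∀⟶∃¬) renaming (_≟_ to _≟ᶠ_)
open import Data.Maybe using (just; nothing)
open import Data.Nat using (ℕ; zero; suc; _+_; _*_; _^_; _∸_; _≤_)
open import Data.Nat.Properties using (+-assoc; +-identityʳ; *-identityˡ)
open import Data.Nat.Tactic.RingSolver using (solve-∀)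
open import Data.Product using (Σ-syntax; ∃; _×_; _,_; proj₁; proj₂)
open import Data.Product.Function.NonDependent.Propositional using (_×-⇔_)
open import Data.Sum using (_⊎_; inj₁; inj₂; [_,_]′; map₂)
import Data.Sum as Sum
open import Data.Unit using (tt)
open import Data.Vec using (Vec; []; _∷_; lookup; replicate; _[_]≔_)
open import Data.Vec.Properties using (lookup∘update; lookup∘update′; ∷-injectiveˡ; ∷-injectiveʳ)
open import Data.Vec.Relation.Binary.Pointwise.Extensional using (ext; Pointwise-≡⇒≡)
open import Function using (_∘_; id)
open import Function.Bundles using (_⇔_; mk⇔; Equivalence)
open import Function.Construct.Composition using (_⇔-∘_)
open import Function.Construct.Symmetry using (⇔-sym)
open import Relation.Binary.PropositionalEquality using (_≡_; _≢_; refl; sym; trans; cong; cong₂; subst)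
open import Relation.Nullary using (¬_; Dec; yes; no; contradiction)

_≟ˢ_ : (a b : Sym) → Dec (a ≡ b)
s0 ≟ˢ s0 = yes refl
s0 ≟ˢ s1 = no λ ()
s0 ≟ˢ s* = no λ ()
s1 ≟ˢ s0 = no λ ()
s1 ≟ˢ s1 = yes refl
s1 ≟ˢ s* = no λ ()
s* ≟ˢ s0 = no λ ()
s* ≟ˢ s1 = no λ ()
s* ≟ˢ s* = yes refl

∧-≡-true⇔ : ∀ {a b} → (a ∧ b ≡ true) ⇔ (a ≡ true × b ≡ true)
∧-≡-true⇔ {true}  = mk⇔ (refl ,_) proj₂
∧-≡-true⇔ {false} = mk⇔ (λ ()) (λ ())

not-≡-true⇔ : ∀ {a} → (not a ≡ true) ⇔ (¬ a ≡ true)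
not-≡-true⇔ {true}  = mk⇔ (λ ()) (λ ¬t → contradiction refl ¬t)
not-≡-true⇔ {false} = mk⇔ (λ _ ()) (λ _ → refl)

Divisor : ∀ {n} → Vec Sym n → Vec Sym n → Set
Divisor t s = ∀ k → lookup t k ≡ lookup s k ⊎ lookup t k ≡ s*

deleteLiteral : ∀ {n} → Vec Sym n → Fin n → Vec Sym n
deleteLiteral s k = s [ k ]≔ s*

LocallyMaximal : ∀ {n} → (Vec Sym n → Set) → Vec Sym n → Set
LocallyMaximal P s = P s × (∀ k → lookup s k ≢ s* → ¬ P (deleteLiteral s k))

Covers-mono : ∀ {n} {t s : Vec Sym n} {x} → Divisor t s → Covers s x → Covers t x
Covers-mono {x = x} t∣s cov k with t∣s k
... | inj₁ eq = subst (λ a → SymMatches a (lookup x k)) (sym eq) (cov k)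
... | inj₂ eq = subst (λ a → SymMatches a (lookup x k)) (sym eq) tt

Implicant-mono : ∀ {n} {f : Vec Bool n → Bool} {t s} → Divisor t s → Implicant f t → Implicant f s
Implicant-mono {t = t} {s} t∣s imp x = imp x ∘ Covers-mono {t = t} {s} {x} t∣s

deleteLiteral-Divisor : ∀ {n} (s : Vec Sym n) k → Divisor (deleteLiteral s k) s
deleteLiteral-Divisor s k j with j ≟ᶠ k
... | yes refl = inj₂ (lookup∘update k s s*)
... | no j≢k   = inj₁ (lookup∘update′ j≢k s s*)

deleteLiteral-≢ : ∀ {n} (s : Vec Sym n) {k} → lookup s k ≢ s* → deleteLiteral s k ≢ s
deleteLiteral-≢ s {k} sₖ≢* eq = sₖ≢* (trans (sym (cong (λ v → lookup v k) eq)) (lookup∘update k s s*))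

Divisor⇒Divisor-deleteLiteral : ∀ {n} {t s : Vec Sym n} {k} → Divisor t s → lookup t k ≡ s* →
                                Divisor t (deleteLiteral s k)
Divisor⇒Divisor-deleteLiteral {s = s} {k} t∣s tₖ≡* j with j ≟ᶠ k | t∣s j
... | yes refl | _        = inj₂ tₖ≡*
... | no j≢k   | inj₁ eq  = inj₁ (trans eq (sym (lookup∘update′ j≢k s s*)))
... | no _     | inj₂ eq  = inj₂ eq

differingPosition : ∀ {n} {t s : Vec Sym n} → t ≢ s → ∃ λ k → lookup t k ≢ lookup s k
differingPosition {n} {t} {s} t≢s =
  ¬∀⟶∃¬ n _ (λ k → lookup t k ≟ˢ lookup s k) (t≢s ∘ Pointwise-≡⇒≡ ∘ ext)

PrimeImplicant⇔LocallyMaximal : ∀ {n} {f : Vec Bool n → Bool} {s} →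
                                PrimeImplicant f s ⇔ LocallyMaximal (Implicant f) s
PrimeImplicant⇔LocallyMaximal {f = f} {s} = mk⇔ to from
  where
  to : PrimeImplicant f s → LocallyMaximal (Implicant f) s
  to (imp , prime) =
    imp , λ k sₖ≢* → prime (deleteLiteral s k) (deleteLiteral-Divisor s k , deleteLiteral-≢ s sₖ≢*)

  from : LocallyMaximal (Implicant f) s → PrimeImplicant f s
  from (imp , maximal) = imp , excluded
    where
    excluded : ∀ t → ProperDivisor t s → ¬ Implicant f t
    excluded t (t∣s , t≢s) impₜ with differingPosition t≢s
    ... | k , tₖ≢sₖ with t∣s k
    ...   | inj₁ tₖ≡sₖ = tₖ≢sₖ tₖ≡sₖ
    ...   | inj₂ tₖ≡* = maximal k (λ sₖ≡* → tₖ≢sₖ (trans tₖ≡* (sym sₖ≡*)))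
                                  (Implicant-mono {t = t} {deleteLiteral s k}
                                    (Divisor⇒Divisor-deleteLiteral {t = t} {s} {k} t∣s tₖ≡*) impₜ)

LocallyMaximal-resp : ∀ {n} {P Q : Vec Sym n → Set} {s} → (∀ t → P t ⇔ Q t) →
                      LocallyMaximal P s ⇔ LocallyMaximal Q s
LocallyMaximal-resp P⇔Q = mk⇔
  (λ (p , m) → Equivalence.to (P⇔Q _) p , λ k sₖ≢* → m k sₖ≢* ∘ Equivalence.from (P⇔Q _))
  (λ (q , m) → Equivalence.from (P⇔Q _) q , λ k sₖ≢* → m k sₖ≢* ∘ Equivalence.to (P⇔Q _))

LocallyMaximal-∷-star : ∀ {n} {P : Vec Sym (suc n) → Set} {s} →
                        LocallyMaximal P (s* ∷ s) ⇔ LocallyMaximal (P ∘ (s* ∷_)) s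
LocallyMaximal-∷-star = mk⇔
  (λ (p , m) → p , m ∘ suc)
  (λ (p , m) → p , λ { zero *≢* → contradiction refl *≢* ; (suc k) → m k })

LocallyMaximal-∷-literal : ∀ {n} {P : Vec Sym (suc n) → Set} {b s} → b ≢ s* →
                           LocallyMaximal P (b ∷ s) ⇔ (LocallyMaximal (P ∘ (b ∷_)) s × ¬ P (s* ∷ s))
LocallyMaximal-∷-literal b≢* = mk⇔
  (λ (p , m) → (p , m ∘ suc) , m zero b≢*)
  (λ ((p , m) , ¬p*) → p , λ { zero _ → ¬p* ; (suc k) → m k })

implicantTable : ∀ {n} → (Vec Sym n → Bool) → Vec Sym n → Bool
implicantTable F []       = F []
implicantTable F (s0 ∷ s) = implicantTable (F ∘ (s0 ∷_)) s
implicantTable F (s1 ∷ s) = implicantTable (F ∘ (s1 ∷_)) s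
implicantTable F (s* ∷ s) = implicantTable (F ∘ (s0 ∷_)) s ∧ implicantTable (F ∘ (s1 ∷_)) s

primeTable : ∀ {n} → (Vec Sym n → Bool) → Vec Sym n → Bool
primeTable J []       = J []
primeTable J (s0 ∷ s) = primeTable (J ∘ (s0 ∷_)) s ∧ not (J (s* ∷ s))
primeTable J (s1 ∷ s) = primeTable (J ∘ (s1 ∷_)) s ∧ not (J (s* ∷ s))
primeTable J (s* ∷ s) = primeTable (J ∘ (s* ∷_)) s

Implicant-[] : {g : Vec Bool 0 → Bool} → Implicant g [] ⇔ (g [] ≡ true)
Implicant-[] = mk⇔ (λ imp → imp [] λ ()) (λ { g[] [] _ → g[] })

Implicant-∷-literal : ∀ {n} {g : Vec Bool (suc n) → Bool} b {s} →
                      Implicant g (embedBit b ∷ s) ⇔ Implicant (g ∘ (b ∷_)) s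
Implicant-∷-literal {g = g} b = mk⇔
  (λ imp x cov → imp (b ∷ x) λ { zero → matches b ; (suc k) → cov k })
  (λ { imp (a ∷ x) cov →
        subst (λ a → g (a ∷ x) ≡ true) (sym (matches⇒≡ b (cov zero))) (imp x (cov ∘ suc)) })
  where
  matches : ∀ b → SymMatches (embedBit b) b
  matches false = refl
  matches true  = refl

  matches⇒≡ : ∀ b {a} → SymMatches (embedBit b) a → a ≡ b
  matches⇒≡ false a≡b = a≡b
  matches⇒≡ true  a≡b = a≡b

Implicant-∷-star : ∀ {n} {g : Vec Bool (suc n) → Bool} {s} →
                   Implicant g (s* ∷ s) ⇔ (Implicant (g ∘ (false ∷_)) s × Implicant (g ∘ (true ∷_)) s)
Implicant-∷-star = mk⇔
  (λ imp → (λ x cov → imp (false ∷ x) λ { zero → tt ; (suc k) → cov k })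
         , (λ x cov → imp (true ∷ x) λ { zero → tt ; (suc k) → cov k }))
  (λ { (imp₀ , imp₁) (false ∷ x) cov → imp₀ x (cov ∘ suc)
     ; (imp₀ , imp₁) (true ∷ x)  cov → imp₁ x (cov ∘ suc) })

implicantTable-true⇔ : ∀ {n} F (s : Vec Sym n) → (implicantTable F s ≡ true) ⇔ Implicant (F ∘ embed) s
implicantTable-true⇔ F []       = ⇔-sym Implicant-[]
implicantTable-true⇔ F (s0 ∷ s) = ⇔-sym (Implicant-∷-literal false) ⇔-∘ implicantTable-true⇔ _ s
implicantTable-true⇔ F (s1 ∷ s) = ⇔-sym (Implicant-∷-literal true) ⇔-∘ implicantTable-true⇔ _ s
implicantTable-true⇔ F (s* ∷ s) =
  ⇔-sym Implicant-∷-star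
  ⇔-∘ ((implicantTable-true⇔ _ s ×-⇔ implicantTable-true⇔ _ s) ⇔-∘ ∧-≡-true⇔)

primeTable-true⇔ : ∀ {n} J (s : Vec Sym n) →
                   (primeTable J s ≡ true) ⇔ LocallyMaximal (λ t → J t ≡ true) s
primeTable-true⇔ J []       = mk⇔ (_, λ ()) proj₁
primeTable-true⇔ J (s0 ∷ s) =
  ⇔-sym (LocallyMaximal-∷-literal {P = λ t → J t ≡ true} λ ())
  ⇔-∘ ((primeTable-true⇔ _ s ×-⇔ not-≡-true⇔) ⇔-∘ ∧-≡-true⇔)
primeTable-true⇔ J (s1 ∷ s) =
  ⇔-sym (LocallyMaximal-∷-literal {P = λ t → J t ≡ true} λ ())
  ⇔-∘ ((primeTable-true⇔ _ s ×-⇔ not-≡-true⇔) ⇔-∘ ∧-≡-true⇔)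
primeTable-true⇔ J (s* ∷ s) =
  ⇔-sym (LocallyMaximal-∷-star {P = λ t → J t ≡ true}) ⇔-∘ primeTable-true⇔ _ s

Encodes : ∀ {n} → (Vec Sym n → Bool) → (Vec Bool n → Bool) → Set
Encodes {n} F f = (s : Vec Sym n) → (F s ≡ true) ⇔ (Σ[ x ∈ Vec Bool n ] ((s ≡ embed x) × (f x ≡ true)))

embed-injective : ∀ {n} {x y : Vec Bool n} → embed x ≡ embed y → x ≡ y
embed-injective {x = []}    {[]}    _  = refl
embed-injective {x = a ∷ x} {b ∷ y} eq =
  cong₂ _∷_ (embedBit-injective a b (∷-injectiveˡ eq)) (embed-injective (∷-injectiveʳ eq))
  where
  embedBit-injective : ∀ a b → embedBit a ≡ embedBit b → a ≡ b
  embedBit-injective false false _ = refl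
  embedBit-injective true  true  _ = refl
  embedBit-injective false true  ()
  embedBit-injective true  false ()

Encodes⇒Implicant⇔ : ∀ {n} {F f} → Encodes F f →
                     ∀ (s : Vec Sym n) → Implicant (F ∘ embed) s ⇔ Implicant f s
Encodes⇒Implicant⇔ {F = F} {f} enc s = mk⇔
  (λ imp x → onPoint x ∘ imp x)
  (λ imp x cov → Equivalence.from (enc (embed x)) (x , refl , imp x cov))
  where
  onPoint : ∀ x → F (embed x) ≡ true → f x ≡ true
  onPoint x Fx with Equivalence.to (enc (embed x)) Fx
  ... | y , eq , fy = subst (λ z → f z ≡ true) (sym (embed-injective eq)) fy

primeTable∘implicantTable-true⇔ : ∀ {n} {F f} → Encodes F f →
  ∀ (s : Vec Sym n) → (primeTable (implicantTable F) s ≡ true) ⇔ PrimeImplicant f s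
primeTable∘implicantTable-true⇔ {F = F} enc s =
  ⇔-sym PrimeImplicant⇔LocallyMaximal
  ⇔-∘ (LocallyMaximal-resp {s = s} (λ t → Encodes⇒Implicant⇔ enc t ⇔-∘ implicantTable-true⇔ F t)
  ⇔-∘ primeTable-true⇔ _ s)

stagedCount : ℕ → ℕ → ℕ
stagedCount c zero    = 0
stagedCount c (suc n) = 3 * stagedCount c n + c * 3 ^ n

stagedCount-suc : ∀ c n → stagedCount c (suc n) ≡ c * (suc n * 3 ^ n)
stagedCount-suc c zero    = refl
stagedCount-suc c (suc n) =
  trans (cong (λ z → 3 * z + c * 3 ^ suc n) (stagedCount-suc c n)) (step c n (3 ^ n))
  where
  step : ∀ c n y → 3 * (c * (suc n * y)) + c * (3 * y) ≡ c * (suc (suc n) * (3 * y))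
  step = solve-∀

stagedCount-1+2 : ∀ n → stagedCount 1 (suc n) + stagedCount 2 (suc n) ≡ suc n * 3 ^ suc n
stagedCount-1+2 n =
  trans (cong₂ _+_ (stagedCount-suc 1 n) (stagedCount-suc 2 n)) (sum (suc n) (3 ^ n))
  where
  sum : ∀ n y → 1 * (n * y) + 2 * (n * y) ≡ n * (3 * y)
  sum = solve-∀

splitLast-inject₁ : ∀ m (j : Fin m) → splitLast m (inject₁ j) ≡ just j
splitLast-inject₁ (suc m) zero    = refl
splitLast-inject₁ (suc m) (suc j) rewrite splitLast-inject₁ m j = refl

splitLast-fromℕ : ∀ m → splitLast m (fromℕ m) ≡ nothing
splitLast-fromℕ zero    = refl
splitLast-fromℕ (suc m) rewrite splitLast-fromℕ m = refl

module Construction {I : Set} where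

  Wire : ℕ → Set
  Wire m = I ⊎ Fin m

  record Extension {m} (c : Circuit I m) (ands ors nots : ℕ) : Set where
    field
      size         : ℕ
      circuit      : Circuit I size
      lift         : Wire m → Wire size
      lift-value   : ∀ x w → wireVal circuit x (lift w) ≡ wireVal c x w
      #AND-circuit : #AND circuit ≡ #AND c + ands
      #OR-circuit  : #OR circuit ≡ #OR c + ors
      #NOT-circuit : #NOT circuit ≡ #NOT c + nots
  open Extension public

  identityExtension : ∀ {m} (c : Circuit I m) → Extension c 0 0 0
  identityExtension c = record
    { circuit = c ; lift = id ; lift-value = λ _ _ → refl
    ; #AND-circuit = sym (+-identityʳ _)
    ; #OR-circuit  = sym (+-identityʳ _)
    ; #NOT-circuit = sym (+-identityʳ _) }

  appendGate : ∀ {m} (c : Circuit I m) (g : Gate (Wire m)) → Extension c (isAND g) (isOR g) (isNOT g)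
  appendGate {m} c g = record
    { circuit = c ▷ g ; lift = map₂ inject₁ ; lift-value = lift-value′
    ; #AND-circuit = refl ; #OR-circuit = refl ; #NOT-circuit = refl }
    where
    lift-value′ : ∀ x w → wireVal (c ▷ g) x (map₂ inject₁ w) ≡ wireVal c x w
    lift-value′ x (inj₁ i) = refl
    lift-value′ x (inj₂ j) rewrite splitLast-inject₁ m j = refl

  appendGate-newest : ∀ {m} (c : Circuit I m) g x →
                      wireVal (c ▷ g) x (inj₂ (fromℕ m)) ≡ evalGate (wireVal c x) g
  appendGate-newest {m} c g x rewrite splitLast-fromℕ m = refl

  _⨾_ : ∀ {m a o k a′ o′ k′} {c : Circuit I m} (e : Extension c a o k) → Extension (circuit e) a′ o′ k′ →
        Extension c (a + a′) (o + o′) (k + k′)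
  _⨾_ {a = a} {o} {k} {a′} {o′} {k′} e e′ = record
    { circuit = circuit e′
    ; lift = lift e′ ∘ lift e
    ; lift-value = λ x w → trans (lift-value e′ x (lift e w)) (lift-value e x w)
    ; #AND-circuit = trans (#AND-circuit e′) (trans (cong (_+ a′) (#AND-circuit e)) (+-assoc _ a a′))
    ; #OR-circuit  = trans (#OR-circuit e′)  (trans (cong (_+ o′) (#OR-circuit e))  (+-assoc _ o o′))
    ; #NOT-circuit = trans (#NOT-circuit e′) (trans (cong (_+ k′) (#NOT-circuit e)) (+-assoc _ k k′)) }

  idleORs : ∀ K {m} (c : Circuit I m) → Wire m → Extension c 0 K 0
  idleORs zero    c w = identityExtension c
  idleORs (suc K) c w = e ⨾ idleORs K (circuit e) (lift e w)
    where e = appendGate c (OR w w)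

  -- A specification quantifies over every valuation F of the input table that agrees with the
  -- actual wire values, so composing builders never needs a congruence argument.
  record Computes {m} (c : Circuit I m) {T U : Set} (inp : T → Wire m) (ands ors nots : ℕ)
                  (Φ : (T → Bool) → U → Bool) : Set where
    field
      extension    : Extension c ands ors nots
      output       : U → Wire (size extension)
      output-value : ∀ x {F} → (∀ t → wireVal c x (inp t) ≡ F t) →
                     ∀ u → wireVal (circuit extension) x (output u) ≡ Φ F u
  open Computes public

  Builder : (T U : Set) (ands ors nots : ℕ) → ((T → Bool) → U → Bool) → Set
  Builder T U ands ors nots Φ = ∀ {m} (c : Circuit I m) (inp : T → Wire m) → Computes c inp ands ors nots Φ

  select : ∀ {T U} (σ : U → T) → Builder T U 0 0 0 (λ F → F ∘ σ)
  select σ c inp = record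
    { extension = identityExtension c ; output = inp ∘ σ ; output-value = λ x agree → agree ∘ σ }

  reindex : ∀ {T T′ U a o k Φ} (ρ : T′ → T) → Builder T′ U a o k Φ → Builder T U a o k (λ F → Φ (F ∘ ρ))
  reindex ρ B c inp = record
    { extension = extension r ; output = output r ; output-value = λ x agree → output-value r x (agree ∘ ρ) }
    where r = B c (inp ∘ ρ)

  respec : ∀ {T U a o k Φ Ψ} → (∀ F u → Φ F u ≡ Ψ F u) → Builder T U a o k Φ → Builder T U a o k Ψ
  respec Φ≗Ψ B c inp = record
    { extension = extension r ; output = output r
    ; output-value = λ x {F} agree u → trans (output-value r x agree u) (Φ≗Ψ F u) }
    where r = B c inp

  infixr 4 _⟫_
  _⟫_ : ∀ {T U V a o k a′ o′ k′ Φ Ψ} → Builder T U a o k Φ → Builder (T ⊎ U) V a′ o′ k′ Ψ →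
        Builder T V (a + a′) (o + o′) (k + k′) (λ F → Ψ [ F , Φ F ]′)
  (B ⟫ B′) c inp = record
    { extension = extension r ⨾ extension r′ ; output = output r′
    ; output-value = λ x agree → output-value r′ x λ
        { (inj₁ t) → trans (lift-value (extension r) x (inp t)) (agree t)
        ; (inj₂ u) → output-value r x agree u } }
    where
    r  = B c inp
    r′ = B′ (circuit (extension r)) [ lift (extension r) ∘ inp , output r ]′

  slicewise : ∀ {T T′ : Set} {n} → (Sym → T′ → T) → ((T′ → Bool) → Vec Sym n → Bool) →
              (T → Bool) → Vec Sym (suc n) → Bool
  slicewise ρ Φ F (b ∷ s) = Φ (F ∘ ρ b) s

  bySlices : ∀ {T T′ n a o k Φ} (ρ : Sym → T′ → T) → Builder T′ (Vec Sym n) a o k Φ →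
             Builder T (Vec Sym (suc n)) (3 * a) (3 * o) (3 * k) (slicewise ρ Φ)
  bySlices {T} {n = n} ρ B =
    respec (λ F → λ { (s0 ∷ s) → refl ; (s1 ∷ s) → refl ; (s* ∷ s) → refl })
      (reindex (ρ s0) B ⟫ reindex (inj₁ ∘ ρ s1) B ⟫ reindex (inj₁ ∘ inj₁ ∘ ρ s*) B ⟫ select slice)
    where
    slice : Vec Sym (suc n) → ((T ⊎ Vec Sym n) ⊎ Vec Sym n) ⊎ Vec Sym n
    slice (s0 ∷ s) = inj₁ (inj₁ (inj₂ s))
    slice (s1 ∷ s) = inj₁ (inj₂ s)
    slice (s* ∷ s) = inj₂ s

  andLayer : ∀ n → Builder (Vec Sym n ⊎ Vec Sym n) (Vec Sym n) (3 ^ n) 0 0 (λ F s → F (inj₁ s) ∧ F (inj₂ s))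
  andLayer zero c inp = record
    { extension = appendGate c (AND (inp (inj₁ [])) (inp (inj₂ []))) ; output = λ _ → inj₂ (fromℕ _)
    ; output-value = λ { x agree [] → trans (appendGate-newest c _ x) (cong₂ _∧_ (agree _) (agree _)) } }
  andLayer (suc n) =
    respec (λ F → λ { (b ∷ s) → refl }) (bySlices (λ b → Sum.map (b ∷_) (b ∷_)) (andLayer n))

  notLayer : ∀ n → Builder (Vec Sym n) (Vec Sym n) 0 0 (3 ^ n) (λ F s → not (F s))
  notLayer zero c inp = record
    { extension = appendGate c (NOT (inp [])) ; output = λ _ → inj₂ (fromℕ _)
    ; output-value = λ { x agree [] → trans (appendGate-newest c _ x) (cong not (agree _)) } }
  notLayer (suc n) = respec (λ F → λ { (b ∷ s) → refl }) (bySlices (λ b → b ∷_) (notLayer n))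

  implicantBuilder : ∀ n → Builder (Vec Sym n) (Vec Sym n) (stagedCount 1 n) 0 0 implicantTable
  implicantBuilder zero    = respec (λ F → λ { [] → refl }) (select id)
  implicantBuilder (suc n) =
    respec (λ F → λ { (s0 ∷ s) → refl ; (s1 ∷ s) → refl ; (s* ∷ s) → refl })
      (bySlices (λ b → b ∷_) (implicantBuilder n) ⟫
       reindex [ (λ s → inj₂ (s0 ∷ s)) , (λ s → inj₂ (s1 ∷ s)) ]′ (andLayer n) ⟫
       select result)
    where
    result : Vec Sym (suc n) → (Vec Sym (suc n) ⊎ Vec Sym (suc n)) ⊎ Vec Sym n
    result (s0 ∷ s) = inj₁ (inj₂ (s0 ∷ s))
    result (s1 ∷ s) = inj₁ (inj₂ (s1 ∷ s))
    result (s* ∷ s) = inj₂ s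

  -- Each stage of _⟫_ sees the earlier wires under inj₁ and the table just computed under inj₂;
  -- here these are J, its sliced prime tables G, ¬ J on the star slice, and the two conjunctions.
  primeBuilder : ∀ n → Builder (Vec Sym n) (Vec Sym n) (stagedCount 2 n) 0 (stagedCount 1 n) primeTable
  primeBuilder zero    = respec (λ F → λ { [] → refl }) (select id)
  primeBuilder (suc n) =
    respec (λ F → λ { (s0 ∷ s) → refl ; (s1 ∷ s) → refl ; (s* ∷ s) → refl })
      (bySlices (λ b → b ∷_) (primeBuilder n) ⟫
       reindex (λ s → inj₁ (s* ∷ s)) (notLayer n) ⟫
       reindex [ (λ s → inj₁ (inj₂ (s0 ∷ s))) , inj₂ ]′ (andLayer n) ⟫
       reindex [ (λ s → inj₁ (inj₁ (inj₂ (s1 ∷ s)))) , inj₁ ∘ inj₂ ]′ (andLayer n) ⟫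
       select result)
    where
    result : Vec Sym (suc n) → (((Vec Sym (suc n) ⊎ Vec Sym (suc n)) ⊎ Vec Sym n) ⊎ Vec Sym n) ⊎ Vec Sym n
    result (s0 ∷ s) = inj₁ (inj₂ s)
    result (s1 ∷ s) = inj₂ s
    result (s* ∷ s) = inj₁ (inj₁ (inj₁ (inj₂ (s* ∷ s))))

  primeImplicantBuilder : ∀ n → Builder (Vec Sym n) (Vec Sym n) (stagedCount 1 n + stagedCount 2 n) 0
                                        (stagedCount 1 n) (primeTable ∘ implicantTable)
  primeImplicantBuilder n = implicantBuilder n ⟫ reindex inj₂ (primeBuilder n)

mainTheorem2 : (n : ℕ) → 1 ≤ n →
    Σ[ m ∈ ℕ ] Σ[ c ∈ Circuit (Vec Sym n) m ]
    Σ[ out ∈ (Vec Sym n → Vec Sym n ⊎ Fin m) ]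
      (#OR c ≡ n * 3 ^ (n ∸ 1)) × (#NOT c ≡ n * 3 ^ (n ∸ 1)) × (#AND c ≡ n * 3 ^ n) ×
      ((f : Vec Bool n → Bool) (input : Vec Sym n → Bool) →
        ((s : Vec Sym n) → (input s ≡ true) ⇔ (Σ[ x ∈ Vec Bool n ] ((s ≡ embed x) × (f x ≡ true)))) →
        (s : Vec Sym n) → (wireVal c input (out s) ≡ true) ⇔ PrimeImplicant f s)
mainTheorem2 zero    ()
mainTheorem2 (suc k) _ =
  size e , circuit e , lift padding ∘ output r ,
  #OR-circuit e , trans (#NOT-circuit e) NOTs , trans (#AND-circuit e) ANDs , correct
  where
  open Construction
  n = suc k

  r : Computes [] inj₁ (stagedCount 1 n + stagedCount 2 n) 0 (stagedCount 1 n) (primeTable ∘ implicantTable)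
  r = primeImplicantBuilder n [] inj₁

  -- The construction uses no OR gates; the required number is met by idle gates OR w w.
  padding : Extension (circuit (extension r)) 0 (n * 3 ^ k) 0
  padding = idleORs (n * 3 ^ k) (circuit (extension r)) (inj₁ (replicate n s*))

  e : Extension [] (stagedCount 1 n + stagedCount 2 n + 0) (0 + n * 3 ^ k) (stagedCount 1 n + 0)
  e = extension r ⨾ padding

  NOTs : stagedCount 1 n + 0 ≡ n * 3 ^ k
  NOTs = trans (+-identityʳ _) (trans (stagedCount-suc 1 k) (*-identityˡ _))

  ANDs : stagedCount 1 n + stagedCount 2 n + 0 ≡ n * 3 ^ n
  ANDs = trans (+-identityʳ _) (stagedCount-1+2 k)

  correct : ∀ f input → Encodes input f → ∀ s →
            (wireVal (circuit e) input (lift padding (output r s)) ≡ true) ⇔ PrimeImplicant f s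
  correct f input enc s =
    subst (λ b → (b ≡ true) ⇔ PrimeImplicant f s) (sym value) (primeTable∘implicantTable-true⇔ enc s)
    where
    value : wireVal (circuit e) input (lift padding (output r s)) ≡ primeTable (implicantTable input) s
    value = trans (lift-value padding input _) (output-value r input (λ _ → refl) s)
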